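{- Let $(X,\sigma,\tau)$ be a solution. (i) If $\sigma_{\sigma_x(y)}=\sigma_y$ and $\sigma_{\tau_x(y)}=\sigma_y$ for all $x,y\in X$, then the left permutation group $\mathcal{G}_\ell(X)=\langle\sigma_x:x\in X\rangle$ is abelian. (ii) If $\tau_{\tau_x(y)}=\tau_y$ and $\tau_{\sigma_x(y)}=\tau_y$ for all $x,y\in X$, then the right permutation group $\mathcal{G}_r(X)=\langle\tau_x:x\in X\rangle$ is abelian. (iii) If the solution is $2$-reductive, then the permutation group $\mathcal{G}(X)=\langle\sigma_x,\tau_y:x,y\in X\rangle$ is abelian.
   Context: A solution is a triple $(X,\sigma,\tau)$ with $X$ a non-empty set and bijections $\sigma_x,\tau_y$ of $X$ such that $r(x,y)=(\sigma_x(y),\tau_y(x))$ is a bijection of $X^2$ satisfying $(\mathrm{id}\times r)(r\times\mathrm{id})(\mathrm{id}\times r)=(r\times\mathrm{id})(\mathrm{id}\times r)(r\times\mathrm{id})$. It is $2$-reductive if for all $x,y$: $\sigma_{\sigma_x(y)}=\sigma_y$, $\tau_{\tau_x(y)}=\tau_y$, $\sigma_{\tau_x(y)}=\sigma_y$, $\tau_{\sigma_x(y)}=\tau_y$. -}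

module Defs where

open import Data.Product using (_×_; _,_)
open import Data.Sum using (_⊎_; inj₁; inj₂)
open import Function using (id; _∘_)
open import Function.Bundles using (_↔_; Inverse)
open import Function.Definitions using (Bijective)
open import Relation.Binary.PropositionalEquality using (_≡_)

module _ {X : Set} (σ τ : X → (X ↔ X)) where
  rMap : X × X → X × X
  rMap (x , y) = (Inverse.to (σ x) y , Inverse.to (τ y) x)

  r×id : X × X × X → X × X × X
  r×id (x , y , z) = (Inverse.to (σ x) y , Inverse.to (τ y) x , z)

  id×r : X × X × X → X × X × X
  id×r (x , y , z) = (x , rMap (y , z))

record Solution : Set₁ where
  field
    X     : Set
    point : X
    σ     : X → (X ↔ X)
    τ     : X → (X ↔ X)
    r-bijective : Bijective _≡_ _≡_ (rMap σ τ)
    braid : ∀ t → id×r σ τ (r×id σ τ (id×r σ τ t)) ≡ r×id σ τ (id×r σ τ (r×id σ τ t))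

  σf : X → X → X
  σf x = Inverse.to (σ x)

  τf : X → X → X
  τf y = Inverse.to (τ y)

-- Membership is a predicate on the underlying maps A → A.
data ⟨_⟩ {A I : Set} (g : I → (A ↔ A)) : (A → A) → Set where
  one : ⟨ g ⟩ id
  gen : ∀ i → ⟨ g ⟩ (Inverse.to (g i))
  inv : ∀ i → ⟨ g ⟩ (Inverse.from (g i))
  mul : ∀ {f h} → ⟨ g ⟩ f → ⟨ g ⟩ h → ⟨ g ⟩ (f ∘ h)

-- A group of permutations is abelian (equality of permutations is pointwise).
Abelian : {A : Set} → ((A → A) → Set) → Set
Abelian {A} G = ∀ {f h} → G f → G h → ∀ (a : A) → f (h a) ≡ h (f a)

module _ (S : Solution) where
  open Solution S

  Gℓ : (X → X) → Set
  Gℓ = ⟨ σ ⟩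

  Gr : (X → X) → Set
  Gr = ⟨ τ ⟩

  στ : X ⊎ X → (X ↔ X)
  στ (inj₁ x) = σ x
  στ (inj₂ y) = τ y

  G : (X → X) → Set
  G = ⟨ στ ⟩

  σ≡ : X → X → Set
  σ≡ a b = ∀ z → σf a z ≡ σf b z

  τ≡ : X → X → Set
  τ≡ a b = ∀ z → τf a z ≡ τf b z

  TwoReductive : Set
  TwoReductive = ∀ x y → σ≡ (σf x y) y × τ≡ (τf x y) y × σ≡ (τf x y) y × τ≡ (σf x y) y

{-# OPTIONS --safe #-}
-- Each component of the braid relation at (x, y, z) is a commutation law
-- between generators up to twisted indices such as σ_{σ_x(y)} and τ_{σ_y(z)};
-- the reductivity hypotheses erase those twists, so the generators commute
-- pairwise, and a group generated by pairwise commuting permutations is abelian.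
module Submission where

open import Defs
open import Data.Product using (_×_; _,_; proj₁; proj₂)
open import Data.Sum using (inj₁; inj₂)
open import Function using (_∘_)
open import Function.Bundles using (_↔_; Inverse)
open import Relation.Binary.PropositionalEquality

Commute : {A : Set} → (A → A) → (A → A) → Set
Commute f h = ∀ a → f (h a) ≡ h (f a)

commute-sym : {A : Set} {f h : A → A} → Commute f h → Commute h f
commute-sym f∘h≡h∘f a = sym (f∘h≡h∘f a)

module _ {A : Set} where
  open Inverse

  commute-from : ∀ {h : A → A} (e : A ↔ A) → Commute h (to e) → Commute h (from e)
  commute-from {h} e h∘e≡e∘h a = begin
    h (from e a)                  ≡⟨ strictlyInverseʳ e _ ⟨
    from e (to e (h (from e a)))  ≡⟨ cong (from e) (h∘e≡e∘h (from e a)) ⟨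
    from e (h (to e (from e a)))  ≡⟨ cong (from e ∘ h) (strictlyInverseˡ e a) ⟩
    from e (h a)                  ∎
    where open ≡-Reasoning

  commute-⟨⟩ : ∀ {I} {g : I → (A ↔ A)} {h : A → A} →
               (∀ i → Commute h (to (g i))) → ∀ {f} → ⟨ g ⟩ f → Commute h f
  commute-⟨⟩ h-gen one a = refl
  commute-⟨⟩ h-gen (gen i) = h-gen i
  commute-⟨⟩ {g = g} h-gen (inv i) = commute-from (g i) (h-gen i)
  commute-⟨⟩ h-gen (mul {f} {k} p q) a =
    trans (commute-⟨⟩ h-gen p (k a)) (cong f (commute-⟨⟩ h-gen q a))

  ⟨⟩-abelian : ∀ {I} (g : I → (A ↔ A)) →
               (∀ i j → Commute (to (g i)) (to (g j))) → Abelian ⟨ g ⟩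
  ⟨⟩-abelian g gens-commute {f} {h} Gf Gh = commute-sym {f = h} (commute-⟨⟩ h-gens Gf)
    where
    h-gens : ∀ i → Commute h (to (g i))
    h-gens i = commute-sym {f = to (g i)} (commute-⟨⟩ (gens-commute i) Gh)

module _ (S : Solution) where
  open Solution S

  σ-braid : ∀ x y z → σf x (σf y z) ≡ σf (σf x y) (σf (τf y x) z)
  σ-braid x y z = cong proj₁ (braid (x , y , z))

  στ-braid : ∀ x y z → σf (τf (σf y z) x) (τf z y) ≡ τf (σf (τf y x) z) (σf x y)
  στ-braid x y z = cong (proj₁ ∘ proj₂) (braid (x , y , z))

  τ-braid : ∀ x y z → τf (τf z y) (τf (σf y z) x) ≡ τf z (τf y x)
  τ-braid x y z = cong (proj₂ ∘ proj₂) (braid (x , y , z))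

  σ-commute : (∀ x y → σ≡ S (σf x y) y) → (∀ x y → σ≡ S (τf x y) y) →
              ∀ x y → Commute (σf x) (σf y)
  σ-commute σ-of-σ σ-of-τ x y z = begin
    σf x (σf y z)                     ≡⟨ σ-braid x y z ⟩
    σf (σf x y) (σf (τf y x) z)       ≡⟨ σ-of-σ x y _ ⟩
    σf y (σf (τf y x) z)              ≡⟨ cong (σf y) (σ-of-τ y x z) ⟩
    σf y (σf x z)                     ∎
    where open ≡-Reasoning

  τ-commute : (∀ x y → τ≡ S (τf x y) y) → (∀ x y → τ≡ S (σf x y) y) →
              ∀ y z → Commute (τf y) (τf z)
  τ-commute τ-of-τ τ-of-σ y z x = begin
    τf y (τf z x)                     ≡⟨ cong (τf y) (τ-of-σ y z x) ⟨
    τf y (τf (σf y z) x)              ≡⟨ τ-of-τ z y _ ⟨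
    τf (τf z y) (τf (σf y z) x)       ≡⟨ τ-braid x y z ⟩
    τf z (τf y x)                     ∎
    where open ≡-Reasoning

  σ-τ-commute : (∀ x y → σ≡ S (τf x y) y) → (∀ x y → τ≡ S (σf x y) y) →
                ∀ x z → Commute (σf x) (τf z)
  σ-τ-commute σ-of-τ τ-of-σ x z y = begin
    σf x (τf z y)                     ≡⟨ σ-of-τ (σf y z) x _ ⟨
    σf (τf (σf y z) x) (τf z y)       ≡⟨ στ-braid x y z ⟩
    τf (σf (τf y x) z) (σf x y)       ≡⟨ τ-of-σ (τf y x) z _ ⟩
    τf z (σf x y)                     ∎
    where open ≡-Reasoning

proposition3p5 : (S : Solution) →
    let open Solution S in
    ((∀ x y → σ≡ S (σf x y) y) → (∀ x y → σ≡ S (τf x y) y) → Abelian (Gℓ S))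
    × ((∀ x y → τ≡ S (τf x y) y) → (∀ x y → τ≡ S (σf x y) y) → Abelian (Gr S))
    × (TwoReductive S → Abelian (G S))
proposition3p5 S =
    (λ σ-of-σ σ-of-τ → ⟨⟩-abelian σ (σ-commute S σ-of-σ σ-of-τ))
  , (λ τ-of-τ τ-of-σ → ⟨⟩-abelian τ (τ-commute S τ-of-τ τ-of-σ))
  , λ reductive → ⟨⟩-abelian (στ S) (generators-commute reductive)
  where
  open Solution S

  generators-commute : TwoReductive S →
                       ∀ i j → Commute (Inverse.to (στ S i)) (Inverse.to (στ S j))
  generators-commute red = λ where
      (inj₁ x) (inj₁ y) → σ-commute S σ-of-σ σ-of-τ x y
      (inj₁ x) (inj₂ z) → σ-τ-commute S σ-of-τ τ-of-σ x z
      (inj₂ z) (inj₁ x) → commute-sym {f = σf x} (σ-τ-commute S σ-of-τ τ-of-σ x z)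
      (inj₂ y) (inj₂ z) → τ-commute S τ-of-τ τ-of-σ y z
    where
    σ-of-σ : ∀ x y → σ≡ S (σf x y) y
    σ-of-σ x y = proj₁ (red x y)
    τ-of-τ : ∀ x y → τ≡ S (τf x y) y
    τ-of-τ x y = proj₁ (proj₂ (red x y))
    σ-of-τ : ∀ x y → σ≡ S (τf x y) y
    σ-of-τ x y = proj₁ (proj₂ (proj₂ (red x y)))
    τ-of-σ : ∀ x y → τ≡ S (σf x y) y
    τ-of-σ x y = proj₂ (proj₂ (proj₂ (red x y)))
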